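{- If $\mathbf{A}$ is a nontrivial (at least two-element) finite semilattice and $C=\mathrm{Clo}(\mathbf{A})$, then the relational structure $(A;C^{\bullet})$ is not polymorphism-homogeneous.
   Context: The graph of an $n$-ary operation $f$ is $f^\bullet=\{(a_1,\dots,a_{n+1})\in A^{n+1}: f(a_1,\dots,a_n)=a_{n+1}\}$, and $C^\bullet=\{f^\bullet: f\in C\}$. A partial $k$-ary operation $h$ (domain $\mathrm{dom}\,h\subseteq A^k$) preserves $\rho\subseteq A^n$ if for every $n\times k$ matrix whose columns lie in $\rho$ and rows $r_1,\dots,r_n$ lie in $\mathrm{dom}\,h$, $(h(r_1),\dots,h(r_n))\in\rho$. A relational structure $(A;R)$ is polymorphism-homogeneous if for every $k\ge1$ every partial $k$-ary operation preserving all of $R$ extends to a total $k$-ary operation preserving all of $R$. -}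

module Defs where

open import Data.Nat using (ℕ; suc; _≤_)
open import Data.Fin using (Fin; inject₁; fromℕ)
open import Data.Maybe using (Maybe; just)
open import Data.Product using (Σ; ∃; _×_)
open import Relation.Binary.PropositionalEquality using (_≡_)

data Term (k : ℕ) : Set where
  var : Fin k → Term k
  _·_ : Term k → Term k → Term k

eval : {A : Set} → (A → A → A) → {k : ℕ} → Term k → (Fin k → A) → A
eval _∙_ (var i) x = x i
eval _∙_ (s · t) x = eval _∙_ s x ∙ eval _∙_ t x

InClo : {A : Set} → (A → A → A) → {m : ℕ} → ((Fin m → A) → A) → Set
InClo {A} _∙_ {m} f = Σ (Term m) λ t → ∀ (x : Fin m → A) → f x ≡ eval _∙_ t x

Relation : Set → ℕ → Set₁
Relation A m = (Fin m → A) → Set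

graph : {A : Set} {m : ℕ} → ((Fin m → A) → A) → Relation A (suc m)
graph {m = m} f a = f (λ i → a (inject₁ i)) ≡ a (fromℕ m)

record RelStructure (A : Set) : Set₁ where
  field
    Idx   : Set
    arity : Idx → ℕ
    rel   : (i : Idx) → Relation A (arity i)

CloGraphs : {A : Set} → (A → A → A) → RelStructure A
CloGraphs {A} _∙_ = record
  { Idx   = Σ ℕ λ m → Σ ((Fin m → A) → A) λ f → InClo _∙_ f
  ; arity = λ p → suc (Σ.proj₁ p)
  ; rel   = λ p → graph (Σ.proj₁ (Σ.proj₂ p))
  }

PartialOp : Set → ℕ → Set
PartialOp A k = (Fin k → A) → Maybe A

PPreserves : {A : Set} {k n : ℕ} → PartialOp A k → Relation A n → Set
PPreserves {A} {k} {n} h ρ =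
  (M : Fin n → Fin k → A) (v : Fin n → A) →
  (∀ j → ρ (λ i → M i j)) →
  (∀ i → h (M i) ≡ just (v i)) →
  ρ v

Preserves : {A : Set} {k n : ℕ} → ((Fin k → A) → A) → Relation A n → Set
Preserves {A} {k} {n} f ρ =
  (M : Fin n → Fin k → A) →
  (∀ j → ρ (λ i → M i j)) →
  ρ (λ i → f (M i))

PolymorphismHomogeneous : {A : Set} → RelStructure A → Set
PolymorphismHomogeneous {A} R =
  (k : ℕ) → 1 ≤ k →
  (h : PartialOp A k) →
  (∀ i → PPreserves h (RelStructure.rel R i)) →
  Σ ((Fin k → A) → A) λ f →
    (∀ i → Preserves f (RelStructure.rel R i)) ×
    (∀ x a → h x ≡ just a → f x ≡ a)

module Submission where

-- Pick c < d in A (any two distinct elements yield such a pair).  Let F be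
-- the flat semilattice on Fin 4 with bottom 0 (u ⊓ v = u if u = v, else 0),
-- and for u ∈ F let row u ∈ A⁴ be the tuple with row u j = d if j ≼ u in F
-- and c otherwise.  The principal-downset map u ↦ row u is an injective
-- homomorphism F → A⁴.  The 4-ary partial operation h has domain
-- {row 1, row 2, row 3} with values d, d, c.
--   * h preserves the graph of every term operation t: if a matrix has rows
--     row σ(i) in dom h and columns in t•, then transporting along the
--     homomorphism row gives t^F(σ) = σ(last), which lies above 0, so in the
--     flat semilattice all variables of t carry the tag σ(last); by
--     idempotence t(h-values) = h-value of the last row.
--   * No total f preserving the graph of ∧ extends h, since
--     row 1 ∧ row 2 = row 0 = row 0 ∧ row 3 forces f(row 0) = d ∧ d = d
--     and f(row 0) = d ∧ c = c.

open import Defs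
open import Data.Nat using (ℕ; _≤_; suc; s≤s; z≤n)
open import Data.Fin using (Fin; zero; suc; inject₁; fromℕ; _≟_)
open import Data.Fin.Properties using (any?; all?)
open import Data.Bool using (Bool; true; false; if_then_else_) renaming (_∧_ to _∧ᵇ_)
open import Data.Bool.Properties using (∧-idem)
open import Data.Maybe using (just; nothing)
open import Data.Product using (Σ; _×_; _,_; proj₁; proj₂)
open import Data.Empty using (⊥-elim)
open import Function using (_∘_)
open import Relation.Nullary using (¬_; yes; no; does)
open import Relation.Nullary.Decidable using (⌊_⌋)
open import Relation.Binary.Definitions using (DecidableEquality)
open import Relation.Binary.PropositionalEquality
  using (_≡_; _≢_; refl; sym; trans; cong; cong₂; module ≡-Reasoning)
open import Algebra.Definitions using (Idempotent)
open import Algebra.Morphism.Definitions using (Homomorphic₂)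
open import Algebra.Lattice.Structures using (IsSemilattice)

open ≡-Reasoning

eval-cong : {B : Set} (_∙_ : B → B → B) {k : ℕ} (t : Term k) {x y : Fin k → B} →
  (∀ i → x i ≡ y i) → eval _∙_ t x ≡ eval _∙_ t y
eval-cong _∙_ (var i) x≗y = x≗y i
eval-cong _∙_ (s · t) x≗y = cong₂ _∙_ (eval-cong _∙_ s x≗y) (eval-cong _∙_ t x≗y)

eval-hom : {M B : Set} {_⊙_ : M → M → M} {_∙_ : B → B → B} (φ : M → B) →
  Homomorphic₂ M B _≡_ φ _⊙_ _∙_ →
  {k : ℕ} (t : Term k) (x : Fin k → M) → φ (eval _⊙_ t x) ≡ eval _∙_ t (φ ∘ x)
eval-hom φ hom (var i) x = refl
eval-hom {_⊙_ = _⊙_} {_∙_} φ hom (s · t) x = begin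
  φ (eval _⊙_ s x ⊙ eval _⊙_ t x)        ≡⟨ hom _ _ ⟩
  φ (eval _⊙_ s x) ∙ φ (eval _⊙_ t x)    ≡⟨ cong₂ _∙_ (eval-hom φ hom s x) (eval-hom φ hom t x) ⟩
  eval _∙_ s (φ ∘ x) ∙ eval _∙_ t (φ ∘ x) ∎

module Flat {r : ℕ} where

  _⊓_ : Fin (suc r) → Fin (suc r) → Fin (suc r)
  u ⊓ v = if does (u ≟ v) then u else zero

  ⊓-above-bottom : ∀ u v {w} → u ⊓ v ≡ w → w ≢ zero → u ≡ w × v ≡ w
  ⊓-above-bottom u v u⊓v≡w w≢0 with u ≟ v
  ... | yes refl = u⊓v≡w , u⊓v≡w
  ... | no _     = ⊥-elim (w≢0 (sym u⊓v≡w))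

  -- If a term evaluates above the bottom of the flat semilattice, all its
  -- variables carry that value; hence in any idempotent magma the term
  -- evaluates to the corresponding image.
  eval-above-bottom : {B : Set} (_∙_ : B → B → B) → Idempotent _≡_ _∙_ →
    (g : Fin (suc r) → B) {k : ℕ} (t : Term k) (τ : Fin k → Fin (suc r)) {w : Fin (suc r)} →
    eval _⊓_ t τ ≡ w → w ≢ zero → eval _∙_ t (g ∘ τ) ≡ g w
  eval-above-bottom _∙_ idem g (var i) τ τi≡w w≢0 = cong g τi≡w
  eval-above-bottom _∙_ idem g (s · t) τ {w} st≡w w≢0 = begin
    eval _∙_ s (g ∘ τ) ∙ eval _∙_ t (g ∘ τ) ≡⟨ cong₂ _∙_ (eval-above-bottom _∙_ idem g s τ s≡w w≢0)
                                                       (eval-above-bottom _∙_ idem g t τ t≡w w≢0) ⟩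
    g w ∙ g w                               ≡⟨ idem (g w) ⟩
    g w                                     ∎
    where
    both≡w : eval _⊓_ s τ ≡ w × eval _⊓_ t τ ≡ w
    both≡w = ⊓-above-bottom (eval _⊓_ s τ) (eval _⊓_ t τ) st≡w w≢0
    s≡w : eval _⊓_ s τ ≡ w
    s≡w = proj₁ both≡w
    t≡w : eval _⊓_ t τ ≡ w
    t≡w = proj₂ both≡w

  _≼_ : Fin (suc r) → Fin (suc r) → Bool
  zero  ≼ u = true
  suc i ≼ u = ⌊ suc i ≟ u ⌋

  ≼-⊓ : ∀ j u v → j ≼ (u ⊓ v) ≡ (j ≼ u) ∧ᵇ (j ≼ v)
  ≼-⊓ zero    u v = refl
  ≼-⊓ (suc i) u v with u ≟ v
  ... | yes refl = sym (∧-idem (suc i ≼ u))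
  ... | no u≢v with suc i ≟ u
  ...   | no _     = refl
  ...   | yes refl with suc i ≟ v
  ...     | yes refl = ⊥-elim (u≢v refl)
  ...     | no _     = refl

  -- ≼ is reflexive and antisymmetric, which makes the downset map injective.
  ≼-refl : ∀ u → u ≼ u ≡ true
  ≼-refl zero    = refl
  ≼-refl (suc i) with suc i ≟ suc i
  ... | yes _  = refl
  ... | no i≢i = ⊥-elim (i≢i refl)

  ≼-antisym : ∀ u v → u ≼ v ≡ true → v ≼ u ≡ true → u ≡ v
  ≼-antisym zero    zero    _ _ = refl
  ≼-antisym (suc i) v u≼v _ with suc i ≟ v
  ... | yes u≡v = u≡v
  ≼-antisym (suc i) v () _ | no _
  ≼-antisym zero    (suc j) _ v≼u with suc j ≟ zero
  ≼-antisym zero    (suc j) _ () | no _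

module Table {A : Set} (_≟ᴬ_ : DecidableEquality A) {r k : ℕ}
  (R : Fin r → Fin k → A) (val : Fin r → A) where

  table : PartialOp A k
  table x with any? (λ e → all? (λ j → x j ≟ᴬ R e j))
  ... | yes (e , _) = just (val e)
  ... | no _        = nothing

  table-inv : ∀ {x a} → table x ≡ just a → Σ (Fin r) λ e → (∀ j → x j ≡ R e j) × a ≡ val e
  table-inv {x} tx≡a with any? (λ e → all? (λ j → x j ≟ᴬ R e j))
  table-inv refl | yes (e , x≗Re) = e , x≗Re , refl

  table-row : (∀ e e' → (∀ j → R e j ≡ R e' j) → val e ≡ val e') →
    ∀ e → table (R e) ≡ just (val e)
  table-row consistent e with any? (λ e' → all? (λ j → R e j ≟ᴬ R e' j))
  ... | yes (e' , Re≗Re') = cong just (sym (consistent e e' Re≗Re'))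
  ... | no ¬match         = ⊥-elim (¬match (e , λ j → refl))

-- A semilattice with two distinct elements has a strictly comparable pair:
-- either a ∧ b = a, or a ∧ b lies strictly below a.
comparable-pair : {A : Set} {_∧_ : A → A → A} → IsSemilattice _≡_ _∧_ →
  DecidableEquality A → ∀ {a b} → a ≢ b →
  Σ A λ c → Σ A λ d → c ≢ d × c ∧ d ≡ c
comparable-pair {_∧_ = _∧_} L _≟ᴬ_ {a} {b} a≢b with (a ∧ b) ≟ᴬ a
... | yes ab≡a = a , b , a≢b , ab≡a
... | no ab≢a  = a ∧ b , a , ab≢a , (begin
  (a ∧ b) ∧ a ≡⟨ cong (_∧ a) (comm a b) ⟩
  (b ∧ a) ∧ a ≡⟨ assoc b a a ⟩
  b ∧ (a ∧ a) ≡⟨ cong (b ∧_) (idem a) ⟩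
  b ∧ a       ≡⟨ comm b a ⟩
  a ∧ b       ∎)
  where open IsSemilattice _≡_ L using (assoc; comm; idem)

module Counterexample {n : ℕ} (_∧_ : Fin n → Fin n → Fin n)
  (L : IsSemilattice _≡_ _∧_) (c d : Fin n) (c≢d : c ≢ d) (c∧d≡c : c ∧ d ≡ c) where

  open IsSemilattice _≡_ L using (comm; idem)
  open Flat {3}

  χ : Bool → Fin n
  χ b = if b then d else c

  χ-hom : ∀ a b → χ (a ∧ᵇ b) ≡ χ a ∧ χ b
  χ-hom true  true  = sym (idem d)
  χ-hom true  false = sym (trans (comm d c) c∧d≡c)
  χ-hom false true  = sym c∧d≡c
  χ-hom false false = sym (idem c)

  χ-true : ∀ {b} → χ b ≡ d → b ≡ true
  χ-true {true}  _   = refl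
  χ-true {false} c≡d = ⊥-elim (c≢d c≡d)

  row : Fin 4 → Fin 4 → Fin n
  row u j = χ (j ≼ u)

  row-hom : ∀ u v j → row (u ⊓ v) j ≡ row u j ∧ row v j
  row-hom u v j = trans (cong χ (≼-⊓ j u v)) (χ-hom (j ≼ u) (j ≼ v))

  row-injective : ∀ {u v} → (∀ j → row u j ≡ row v j) → u ≡ v
  row-injective {u} {v} u≗v = ≼-antisym u v
    (χ-true (trans (sym (u≗v u)) (cong χ (≼-refl u))))
    (χ-true (trans (u≗v v) (cong χ (≼-refl v))))

  value : Fin 4 → Fin n
  value (suc (suc (suc zero))) = c
  value _                      = d

  open Table _≟_ (row ∘ suc) (value ∘ suc) renaming (table to h)

  -- Distinct tags have distinct rows, so each row lies in the domain of h.
  h-row : ∀ e → h (row (suc e)) ≡ just (value (suc e))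
  h-row = table-row λ e e' Re≗Re' → cong value (row-injective Re≗Re')

  h-preserves : ∀ i → PPreserves h (RelStructure.rel (CloGraphs _∧_) i)
  h-preserves (m , f , t , f≗t) M v columns in-dom = begin
    f (v ∘ inject₁)                   ≡⟨ f≗t _ ⟩
    eval _∧_ t (v ∘ inject₁)          ≡⟨ eval-cong _∧_ t (v≡value ∘ inject₁) ⟩
    eval _∧_ t (value ∘ σ ∘ inject₁)  ≡⟨ eval-above-bottom _∧_ idem value t (σ ∘ inject₁) flat-value (λ ()) ⟩
    value (σ (fromℕ m))               ≡⟨ sym (v≡value (fromℕ m)) ⟩
    v (fromℕ m)                       ∎
    where
    σ : Fin (suc m) → Fin 4
    σ i = suc (proj₁ (table-inv (in-dom i)))
    M≡row : ∀ i j → M i j ≡ row (σ i) j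
    M≡row i = proj₁ (proj₂ (table-inv (in-dom i)))
    v≡value : ∀ i → v i ≡ value (σ i)
    v≡value i = proj₂ (proj₂ (table-inv (in-dom i)))
    -- transported along row, the columns say that t computes the tag of the
    -- last row from the tags of the others in the flat semilattice
    flat-value : eval _⊓_ t (σ ∘ inject₁) ≡ σ (fromℕ m)
    flat-value = row-injective λ j → begin
      row (eval _⊓_ t (σ ∘ inject₁)) j          ≡⟨ eval-hom (λ u → row u j) (λ u w → row-hom u w j) t _ ⟩
      eval _∧_ t (λ i → row (σ (inject₁ i)) j)  ≡⟨ eval-cong _∧_ t (λ i → sym (M≡row (inject₁ i) j)) ⟩
      eval _∧_ t (λ i → M (inject₁ i) j)        ≡⟨ sym (f≗t _) ⟩
      f (λ i → M (inject₁ i) j)                 ≡⟨ columns j ⟩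
      M (fromℕ m) j                             ≡⟨ M≡row (fromℕ m) j ⟩
      row (σ (fromℕ m)) j                       ∎

  meet-graph : RelStructure.Idx (CloGraphs _∧_)
  meet-graph = 2 , (λ x → x zero ∧ x (suc zero)) , var zero · var (suc zero) , λ _ → refl

  preserves-meet : (f : (Fin 4 → Fin n) → Fin n) →
    Preserves f (RelStructure.rel (CloGraphs _∧_) meet-graph) →
    ∀ x y z → (∀ j → x j ∧ y j ≡ z j) → f x ∧ f y ≡ f z
  preserves-meet f f-pres x y z xy≗z = f-pres matrix xy≗z
    where
    matrix : Fin 3 → Fin 4 → Fin n
    matrix zero             = x
    matrix (suc zero)       = y
    matrix (suc (suc zero)) = z

  -- No total operation preserving the graph of ∧ extends h: both
  -- row 1 ∧ row 2 = row 0 and row 0 ∧ row 3 = row 0 hold in A⁴.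
  no-extension : ¬ PolymorphismHomogeneous (CloGraphs _∧_)
  no-extension ph with ph 4 (s≤s z≤n) h h-preserves
  ... | f , f-pres , f-extends = c≢d (sym (begin
    d                       ≡⟨ sym f⟨r₀⟩≡d ⟩
    f (row r₀)              ≡⟨ sym (f-meet r₀ r₃) ⟩
    f (row r₀) ∧ f (row r₃) ≡⟨ cong₂ _∧_ f⟨r₀⟩≡d (f-on-row (suc (suc zero))) ⟩
    d ∧ c                   ≡⟨ trans (comm d c) c∧d≡c ⟩
    c                       ∎))
    where
    r₀ r₁ r₂ r₃ : Fin 4
    r₀ = zero
    r₁ = suc zero
    r₂ = suc (suc zero)
    r₃ = suc (suc (suc zero))
    f-on-row : ∀ e → f (row (suc e)) ≡ value (suc e)
    f-on-row e = f-extends _ _ (h-row e)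
    f-meet : ∀ u v → f (row u) ∧ f (row v) ≡ f (row (u ⊓ v))
    f-meet u v = preserves-meet f (f-pres meet-graph) (row u) (row v) (row (u ⊓ v))
      (λ j → sym (row-hom u v j))
    f⟨r₀⟩≡d : f (row r₀) ≡ d
    f⟨r₀⟩≡d = begin
      f (row r₀)              ≡⟨ sym (f-meet r₁ r₂) ⟩
      f (row r₁) ∧ f (row r₂) ≡⟨ cong₂ _∧_ (f-on-row zero) (f-on-row (suc zero)) ⟩
      d ∧ d                   ≡⟨ idem d ⟩
      d                       ∎

theorem4p3 : (n : ℕ) → 2 ≤ n → (_∧_ : Fin n → Fin n → Fin n) →
    IsSemilattice _≡_ _∧_ →
    ¬ PolymorphismHomogeneous (CloGraphs _∧_)
theorem4p3 (suc (suc n)) (s≤s (s≤s z≤n)) _∧_ L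
  with comparable-pair L _≟_ {zero} {suc zero} (λ ())
... | c , d , c≢d , c∧d≡c = Counterexample.no-extension _∧_ L c d c≢d c∧d≡c
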